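{- The update operation $\texttt{add\_contact}(u,v,t)$ (Algorithm 1 below) has amortized time complexity $O(n^2\log\tau)$, and in the worst case a single update operation costs $O(n^2\tau)$ time. Algorithm 1: (1) $\textsc{insert}(u,v,t,t+\delta)$; (2) $D\gets\emptyset$; (3) for every $w^-\in\mathcal{N}^*_{in}(u)$: let $[t^-,\cdot]=\textsc{find\_previous}(w^-,u,t)$; if it exists, $\textsc{insert}(w^-,v,t^-,t+\delta)$ and add $(w^-,t^-)$ to $D$; (4) for every $w^+\in\mathcal{N}^*_{out}(v)$: let $[\cdot,t^+]=\textsc{find\_next}(v,w^+,t+\delta)$; if it exists, $\textsc{insert}(u,w^+,t,t^+)$ and, for every $(w^-,t^-)\in D$ with $w^-\ne w^+$, $\textsc{insert}(w^-,w^+,t^-,t^+)$.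
   Context: A temporal graph has vertex set $V$ with $|V|=n$, lifetime $[1,\tau]$ with integer timestamps, and constant latency $\delta\in\mathbb{N}$; a new contact $(u,v,t)$ with $u\ne v$ means arc $(u,v)$ is present at time $t$. The data structure is an $n\times n$ matrix whose entry $(x,y)$ points to a self-balancing BST $T(x,y)$ of pairwise incomparable time intervals keyed by departure. $\textsc{find\_next}(x,y,s)$ returns the interval $[t^-,t^+]$ in $T(x,y)$ with the earliest $t^-\ge s$ (or nil); $\textsc{find\_previous}(x,y,s)$ returns the interval with the latest $t^+\le s$ (or nil); both take $O(\log\tau)$ time. $\textsc{insert}(x,y,t^-,t^+)$ removes from $T(x,y)$ all stored intervals containing $[t^-,t^+]$ and then inserts $[t^-,t^+]$; it costs $O(d+\log\tau)$ in the worst case, where $d$ is the number of removed intervals, and $O(\log\tau)$ amortized. $\mathcal{N}^*_{out}(x)$ (resp. $\mathcal{N}^*_{in}(x)$) is the set of vertices $y$ with $T(x,y)$ (resp. $T(y,x)$) nonempty, computed in $O(n)$ time by scanning a row (resp. column) of the matrix. Amortization is over a sequence of \texttt{add\_contact} operations starting from the empty structure. -}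

module Defs where

open import Data.Nat using (ℕ; zero; suc; _+_; _*_; _∸_; _≤_; _≤ᵇ_)
open import Data.Nat.Logarithm using (⌈log₂_⌉)
open import Data.Bool using (Bool; true; false; not; _∧_; if_then_else_)
open import Data.Fin using (Fin; _≟_)
open import Data.List using (List; []; _∷_; length; filterᵇ; allFin; null)
open import Data.Bool.ListAction using (any)
open import Data.Maybe using (Maybe; nothing; just)
open import Data.Product using (Σ; _×_; _,_; proj₁; proj₂)
open import Relation.Nullary using (yes; no; ¬_)
open import Relation.Binary.PropositionalEquality using (_≡_)

Interval : Set
Interval = ℕ × ℕ

-- The BST T(x,y) is modelled abstractly as the list of its stored intervals;
-- the costs of the BST operations are charged according to the cost model
-- given in the paper (see below), not according to the list representation.
Tree : Set
Tree = List Interval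

State : ℕ → Set
State n = Fin n → Fin n → Tree

emptyState : (n : ℕ) → State n
emptyState n = λ _ _ → []

contains : Interval → Interval → Bool
contains (a , b) (c , d) = (a ≤ᵇ c) ∧ (d ≤ᵇ b)

record Contact (n : ℕ) : Set where
  constructor contact
  field
    src  : Fin n
    tgt  : Fin n
    time : ℕ

record Valid {n : ℕ} (τ : ℕ) (c : Contact n) : Set where
  field
    distinct : ¬ (Contact.src c ≡ Contact.tgt c)
    lower    : 1 ≤ Contact.time c
    upper    : Contact.time c ≤ τ

-- The "log τ" unit of the cost model (made ≥ 1 so that O(log τ) operations
-- cost at least one step also when τ = 1).
logCost : ℕ → ℕ
logCost τ = suc ⌈log₂ τ ⌉

-- If some stored
-- interval is contained in I (so I is dominated, and inserting it would break
-- pairwise incomparability), the tree is left unchanged (d = 0).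
insertTree : Interval → Tree → Tree × ℕ
insertTree i T =
  if any (λ j → contains i j) T
  then (T , 0)
  else (let T' = filterᵇ (λ j → not (contains j i)) T
        in (i ∷ T') , (length T ∸ length T'))

findNext : Tree → ℕ → Maybe Interval
findNext [] s = nothing
findNext ((a , b) ∷ T) s with findNext T s
... | nothing       = if s ≤ᵇ a then just (a , b) else nothing
... | just (a' , b') = if (s ≤ᵇ a) ∧ (a ≤ᵇ a') then just (a , b) else just (a' , b')

findPrevious : Tree → ℕ → Maybe Interval
findPrevious [] s = nothing
findPrevious ((a , b) ∷ T) s with findPrevious T s
... | nothing       = if b ≤ᵇ s then just (a , b) else nothing
... | just (a' , b') = if (b ≤ᵇ s) ∧ (b' ≤ᵇ b) then just (a , b) else just (a' , b')

module Algorithm (n τ δ : ℕ) where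

  L : ℕ
  L = logCost τ

  setEntry : State n → Fin n → Fin n → Tree → State n
  setEntry S x y T' x' y' with x' ≟ x | y' ≟ y
  ... | yes _ | yes _ = T'
  ... | _     | _     = S x' y'

  insert : State n → Fin n → Fin n → ℕ → ℕ → State n × ℕ
  insert S x y tm tp =
    let r = insertTree (tm , tp) (S x y)
    in setEntry S x y (proj₁ r) , (proj₂ r + L)

  -- N*_out(x) and N*_in(x) (each computed in n steps by a row/column scan).
  Nout : State n → Fin n → List (Fin n)
  Nout S x = filterᵇ (λ y → not (null (S x y))) (allFin n)

  Nin : State n → Fin n → List (Fin n)
  Nin S x = filterᵇ (λ y → not (null (S y x))) (allFin n)

  step3 : State n → Fin n → Fin n → ℕ → List (Fin n) → List (Fin n × ℕ)
        → State n × List (Fin n × ℕ) × ℕ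
  step3 S u v t [] D = S , D , 0
  step3 S u v t (w ∷ ws) D with findPrevious (S w u) t
  ... | nothing =
        let (S' , D' , c) = step3 S u v t ws D
        in S' , D' , L + c
  ... | just (tm , _) =
        let (S1 , c1) = insert S w v tm (t + δ)
            (S' , D' , c) = step3 S1 u v t ws ((w , tm) ∷ D)
        in S' , D' , L + c1 + 1 + c

  insertD : State n → Fin n → ℕ → List (Fin n × ℕ) → State n × ℕ
  insertD S w tp [] = S , 0
  insertD S w tp ((wm , tm) ∷ D) with wm ≟ w
  ... | yes _ =
        let (S' , c) = insertD S w tp D
        in S' , 1 + c
  ... | no _ =
        let (S1 , c1) = insert S wm w tm tp
            (S' , c) = insertD S1 w tp D
        in S' , 1 + c1 + c

  step4 : State n → Fin n → Fin n → ℕ → List (Fin n × ℕ) → List (Fin n) → State n × ℕ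
  step4 S u v t D [] = S , 0
  step4 S u v t D (w ∷ ws) with findNext (S v w) (t + δ)
  ... | nothing =
        let (S' , c) = step4 S u v t D ws
        in S' , L + c
  ... | just (_ , tp) =
        let (S1 , c1) = insert S u w t tp
            (S2 , c2) = insertD S1 w tp D
            (S' , c) = step4 S2 u v t D ws
        in S' , L + c1 + c2 + c

  addContact : State n → Contact n → State n × ℕ
  addContact S (contact u v t) =
    let (S1 , c1) = insert S u v t (t + δ)
        (S2 , D , c2) = step3 S1 u v t (Nin S1 u) []
        (S3 , c3) = step4 S2 u v t D (Nout S2 v)
    in S3 , (1 + c1 + n + c2 + n + c3)

  run : State n → List (Contact n) → State n × ℕ
  run S [] = S , 0
  run S (c ∷ cs) =
    let (S1 , k1) = addContact S c
        (S2 , k2) = run S1 cs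
    in S2 , (k1 + k2)

  stateAfter : List (Contact n) → State n
  stateAfter cs = proj₁ (run (emptyState n) cs)

-- The potential of a state is the total number of stored intervals.  An
-- insert that removes d intervals costs d + log τ and changes the potential
-- by at most 1 − d, so its amortised cost is at most 1 + log τ.  One
-- add_contact performs O(n²) inserts and O(n) queries and row/column scans,
-- hence has amortised cost O(n² log τ); starting from potential 0 this bounds
-- the total cost of any sequence.  For the worst case, the intervals of one
-- tree are pairwise incomparable, so they have distinct departures in [0, τ]
-- and a tree holds at most τ + 1 of them; the actual cost of one operation is
-- at most its amortised cost plus the potential n²(τ + 1) before it.
module Submission where

open import Defs
open import Data.Nat using (ℕ; zero; suc; _+_; _*_; _^_; _≤_; _<_; _≤ᵇ_; z≤n; s≤s)
open import Data.Nat.Properties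
  using ( +-comm; +-assoc; +-suc; +-identityʳ; +-mono-≤; +-monoˡ-≤; +-monoʳ-≤; +-cancelʳ-≤
        ; *-mono-≤; *-monoˡ-≤; *-monoʳ-≤; +-0-commutativeMonoid; m^n>0
        ; ≤-refl; ≤-trans; ≤-reflexive; ≤-total; <⇒≤; ≮⇒≥; ≤⇒≤ᵇ
        ; m≤m+n; m≤n⇒m≤1+n; n≤1+n; m∸n+n≡m; module ≤-Reasoning )
open import Data.Nat.Tactic.RingSolver using (solve-∀)
open import Data.Nat.Logarithm using (⌈log₂_⌉; ⌈log₂⌉-mono-≤; ⌈log₂2^n⌉≡n)
open import Data.Bool using (Bool; true; false; _∧_; T)
open import Data.Bool.Properties using (T-∧; T-not-≡)
open import Data.Bool.ListAction using (any)
open import Data.Sum using (inj₁; inj₂)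
open import Data.Fin using (Fin; zero; suc; toℕ; fromℕ<; punchIn; _≟_)
open import Data.Fin.Properties using (pigeonhole; toℕ-fromℕ<; punchInᵢ≢i)
open import Data.List using (List; []; _∷_; length; lookup; filterᵇ; allFin)
open import Data.List.Membership.Propositional using (_∈_)
open import Data.List.Membership.Propositional.Properties using (∈-lookup)
open import Data.List.Relation.Unary.All as All using (All; []; _∷_)
open import Data.List.Relation.Unary.All.Properties as All using (all-filter; ¬Any⇒All¬)
open import Data.List.Relation.Unary.AllPairs as AllPairs using (AllPairs; []; _∷_)
import Data.List.Relation.Unary.AllPairs.Properties as AllPairs
open import Data.List.Relation.Unary.Any using (here; there)
open import Data.List.Relation.Unary.Any.Properties using (any⁺)
import Data.List.Properties as List
open import Data.Maybe using (just; nothing)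
open import Data.Maybe.Properties using (just-injective)
open import Data.Product using (Σ; _×_; _,_; proj₁; proj₂)
open import Data.Vec.Functional using (Vector)
open import Function using (_∘_; id)
open import Function.Bundles using (Equivalence)
open import Relation.Nullary using (¬_; contradiction; yes; no)
open import Relation.Binary.PropositionalEquality
open import Algebra.Properties.CommutativeMonoid.Sum +-0-commutativeMonoid
  using (sum; sum-remove; sum-cong-≗; sum-replicate-zero)

record Amortised (cost before after budget : ℕ) : Set where
  constructor amortised
  field bound : cost + after ≤ before + budget

pay : ∀ c p → Amortised c p p c
pay c p = amortised (≤-reflexive (+-comm c p))

infixl 4 _⨾_
_⨾_ : ∀ {c₁ c₂ p₀ p₁ p₂ k₁ k₂} →
      Amortised c₁ p₀ p₁ k₁ → Amortised c₂ p₁ p₂ k₂ → Amortised (c₁ + c₂) p₀ p₂ (k₁ + k₂)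
_⨾_ {c₁} {c₂} {p₀} {p₁} {p₂} {k₁} {k₂} (amortised h₁) (amortised h₂) = amortised (begin
  c₁ + c₂ + p₂   ≡⟨ +-assoc c₁ c₂ p₂ ⟩
  c₁ + (c₂ + p₂) ≤⟨ +-monoʳ-≤ c₁ h₂ ⟩
  c₁ + (p₁ + k₂) ≡⟨ +-assoc c₁ p₁ k₂ ⟨
  c₁ + p₁ + k₂   ≤⟨ +-monoˡ-≤ k₂ h₁ ⟩
  p₀ + k₁ + k₂   ≡⟨ +-assoc p₀ k₁ k₂ ⟩
  p₀ + (k₁ + k₂) ∎)
  where open ≤-Reasoning

relax : ∀ {c p q k k′} → k ≤ k′ → Amortised c p q k → Amortised c p q k′
relax {p = p} k≤k′ (amortised h) = amortised (≤-trans h (+-monoʳ-≤ p k≤k′))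

Amortised⇒cost≤ : ∀ {c p q k} → Amortised c p q k → c ≤ p + k
Amortised⇒cost≤ {c} {q = q} (amortised h) = ≤-trans (m≤m+n c q) h

sum-cong-except : ∀ {n} {f g : Vector ℕ n} i {a b} →
                  (∀ k → k ≢ i → f k ≡ g k) → f i + a ≡ g i + b → sum f + a ≡ sum g + b
sum-cong-except {suc n} {f} {g} i {a} {b} f≗g fi+a≡gi+b = begin
  sum f + a                        ≡⟨ cong (_+ a) (sum-remove f) ⟩
  f i + sum (f ∘ punchIn i) + a    ≡⟨ +-comm-middle (f i) _ a ⟩
  f i + a + sum (f ∘ punchIn i)    ≡⟨ cong₂ _+_ fi+a≡gi+b (sum-cong-≗ (λ k → f≗g _ (punchInᵢ≢i i k))) ⟩
  g i + b + sum (g ∘ punchIn i)    ≡⟨ +-comm-middle (g i) _ b ⟨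
  g i + sum (g ∘ punchIn i) + b    ≡⟨ cong (_+ b) (sum-remove g) ⟨
  sum g + b                        ∎
  where
  open ≡-Reasoning
  +-comm-middle : ∀ x y z → x + y + z ≡ x + z + y
  +-comm-middle = solve-∀

sum-≤-* : ∀ {n} (f : Vector ℕ n) {b} → (∀ k → f k ≤ b) → sum f ≤ n * b
sum-≤-* {zero}  f f≤b = z≤n
sum-≤-* {suc n} f f≤b = +-mono-≤ (f≤b zero) (sum-≤-* (f ∘ suc) (f≤b ∘ suc))

AllPairs-lookup : ∀ {A : Set} {R : A → A → Set} {xs} → AllPairs R xs →
                  ∀ {i j} → i Data.Fin.< j → R (lookup xs i) (lookup xs j)
AllPairs-lookup (Rx ∷ _)   {zero}  {suc j} _           = All.lookup Rx (∈-lookup j)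
AllPairs-lookup (_  ∷ Rxs) {suc i} {suc j} (s≤s i<j) = AllPairs-lookup Rxs i<j

distinctKeys⇒length≤ : ∀ {A : Set} (key : A → ℕ) {m xs} →
                       AllPairs (λ x y → key x ≢ key y) xs → All (λ x → key x ≤ m) xs →
                       length xs ≤ suc m
distinctKeys⇒length≤ key {m} {xs} distinct bounded = ≮⇒≥ λ m<length →
  let i , j , i<j , same-slot = pigeonhole m<length slot
  in AllPairs-lookup distinct i<j
       (trans (sym (toℕ-fromℕ< _)) (trans (cong toℕ same-slot) (toℕ-fromℕ< _)))
  where
  slot : Fin (length xs) → Fin (suc m)
  slot k = fromℕ< (s≤s (All.lookup bounded (∈-lookup k)))

departure : Interval → ℕ
departure = proj₁

-- Incomparability of the stored intervals is only used through the weaker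
-- fact that their departures are distinct.
record Proper (τ : ℕ) (ts : Tree) : Set where
  field
    distinct : AllPairs (λ i j → departure i ≢ departure j) ts
    bounded  : All (λ i → departure i ≤ τ) ts

Proper-length≤ : ∀ {τ ts} → Proper τ ts → length ts ≤ suc τ
Proper-length≤ p = distinctKeys⇒length≤ departure (Proper.distinct p) (Proper.bounded p)

contains-intro : ∀ {a b c d} → a ≤ c → d ≤ b → T (contains (a , b) (c , d))
contains-intro a≤c d≤b = Equivalence.from T-∧ (≤⇒≤ᵇ a≤c , ≤⇒≤ᵇ d≤b)

incomparable⇒departure≢ : ∀ i j → ¬ T (contains i j) → ¬ T (contains j i) → departure i ≢ departure j
incomparable⇒departure≢ (a , b) (.a , b′) i⊉j j⊉i refl with ≤-total b b′
... | inj₁ b≤b′ = j⊉i (contains-intro (≤-refl {a}) b≤b′)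
... | inj₂ b′≤b = i⊉j (contains-intro (≤-refl {a}) b′≤b)

insertTree-proper : ∀ {τ} i ts → departure i ≤ τ → Proper τ ts → Proper τ (proj₁ (insertTree i ts))
insertTree-proper i ts i≤τ p with any (λ j → contains i j) ts in dominated
... | true  = p
... | false = record
  { distinct = All.zipWith (λ (i⊉j , j⊉i) → incomparable⇒departure≢ i _ i⊉j (subst T (Equivalence.to T-not-≡ j⊉i)))
                 (All.filter⁺ _ i⊉ts , all-filter _ ts)
               ∷ AllPairs.filter⁺ _ (Proper.distinct p)
  ; bounded  = i≤τ ∷ All.filter⁺ _ (Proper.bounded p)
  }
  where
  i⊉ts : All (λ j → ¬ T (contains i j)) ts
  i⊉ts = ¬Any⇒All¬ ts (λ i⊇j → subst T dominated (any⁺ _ i⊇j))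

insertTree-length : ∀ i ts → proj₂ (insertTree i ts) + length (proj₁ (insertTree i ts)) ≤ suc (length ts)
insertTree-length i ts with any (λ j → contains i j) ts
... | true  = n≤1+n _
... | false = ≤-reflexive (trans (+-suc _ _) (cong suc (m∸n+n≡m (List.length-filter _ ts))))

findPrevious-∈ : ∀ ts {s i} → findPrevious ts s ≡ just i → i ∈ ts
findPrevious-∈ ((a , b) ∷ ts) {s} found with findPrevious ts s in found′
... | nothing with b ≤ᵇ s
...   | true  = here (sym (just-injective found))
...   | false = contradiction found λ ()
findPrevious-∈ ((a , b) ∷ ts) {s} found | just (a′ , b′) with (b ≤ᵇ s) ∧ (b′ ≤ᵇ b)
...   | true  = here (sym (just-injective found))
...   | false = there (findPrevious-∈ ts (trans found′ found))

step3Budget : ℕ → ℕ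
step3Budget L = L + suc L + 1

insertDBudget : ℕ → ℕ
insertDBudget L = 1 + suc L

step4Budget : ℕ → ℕ → ℕ
step4Budget L d = L + suc L + d * insertDBudget L

addContactBudget : ℕ → ℕ → ℕ
addContactBudget n L = 1 + suc L + n + n * step3Budget L + n + n * step4Budget L n

addContactBudget≤ : ∀ {n} → Fin n → ∀ l → addContactBudget n (suc l) ≤ 15 * (n * n * suc l)
addContactBudget≤ {suc m} _ l =
  -- the added polynomial is exactly the difference of the two sides
  ≤-trans (m≤m+n _ (15 * m + 12 * m * m + 9 * l + 24 * m * l + 14 * m * m * l))
          (≤-reflexive (expand m l))
  where
  expand : ∀ m l →
    1 + (2 + l) + (1 + m) + (1 + m) * ((1 + l) + (2 + l) + 1) + (1 + m)
      + (1 + m) * ((1 + l) + (2 + l) + (1 + m) * (1 + (2 + l)))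
      + (15 * m + 12 * m * m + 9 * l + 24 * m * l + 14 * m * m * l)
    ≡ 15 * ((1 + m) * (1 + m) * (1 + l))
  expand = solve-∀

m<2^m : ∀ m → m < 2 ^ m
m<2^m zero    = s≤s z≤n
m<2^m (suc m) = +-mono-≤ (m^n>0 2 m) (≤-trans (m<2^m m) (≤-reflexive (sym (+-identityʳ (2 ^ m)))))

logCost≤1+ : ∀ {τ} → logCost τ ≤ suc τ
logCost≤1+ {τ} = s≤s (≤-trans (⌈log₂⌉-mono-≤ (<⇒≤ (m<2^m τ))) (≤-reflexive (⌈log₂2^n⌉≡n τ)))

stored+budget≤ : ∀ n {τ L} → 1 ≤ τ → L ≤ suc τ → n * (n * suc τ) + 15 * (n * n * L) ≤ 32 * (n * n) * τ
stored+budget≤ n {suc t} {L} _ L≤2+t = begin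
  n * (n * (2 + t)) + 15 * (n * n * L)        ≤⟨ +-monoʳ-≤ (n * (n * (2 + t))) (*-monoʳ-≤ 15 (*-monoʳ-≤ (n * n) L≤2+t)) ⟩
  n * (n * (2 + t)) + 15 * (n * n * (2 + t))  ≡⟨ collect n t ⟩
  16 * (n * n) * (2 + t)                      ≤⟨ *-monoʳ-≤ (16 * (n * n)) (+-monoʳ-≤ 2 (m≤m+n t t)) ⟩
  16 * (n * n) * (2 + (t + t))                ≡⟨ double n t ⟩
  32 * (n * n) * (1 + t)                      ∎
  where
  open ≤-Reasoning
  collect : ∀ n t → n * (n * (2 + t)) + 15 * (n * n * (2 + t)) ≡ 16 * (n * n) * (2 + t)
  collect = solve-∀
  double : ∀ n t → 16 * (n * n) * (2 + (t + t)) ≡ 32 * (n * n) * (1 + t)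
  double = solve-∀

module Analysis (n τ δ : ℕ) where
  open Algorithm n τ δ

  size : State n → ℕ
  size S = sum λ x → sum λ y → length (S x y)

  setEntry-≡ : ∀ S x y ts → setEntry S x y ts x y ≡ ts
  setEntry-≡ S x y ts with x ≟ x | y ≟ y
  ... | yes _     | yes _     = refl
  ... | no  x≢x   | _         = contradiction refl x≢x
  ... | yes _     | no  y≢y   = contradiction refl y≢y

  setEntry-≢ : ∀ S x y ts x′ y′ → ¬ (x′ ≡ x × y′ ≡ y) → setEntry S x y ts x′ y′ ≡ S x′ y′
  setEntry-≢ S x y ts x′ y′ ≢xy with x′ ≟ x | y′ ≟ y
  ... | yes x′≡x | yes y′≡y = contradiction (x′≡x , y′≡y) ≢xy
  ... | yes _    | no  _    = refl
  ... | no  _    | _        = refl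

  size-setEntry : ∀ S x y ts → size (setEntry S x y ts) + length (S x y) ≡ size S + length ts
  size-setEntry S x y ts =
    sum-cong-except x (λ x′ x′≢x → sum-cong-≗ λ y′ → cong length (setEntry-≢ S x y ts x′ y′ (x′≢x ∘ proj₁)))
      (sum-cong-except y (λ y′ y′≢y → cong length (setEntry-≢ S x y ts x y′ (y′≢y ∘ proj₂)))
        (trans (cong (λ ts′ → length ts′ + length (S x y)) (setEntry-≡ S x y ts)) (+-comm (length ts) _)))

  insert-amortised : ∀ S x y a b →
    Amortised (proj₂ (insert S x y a b)) (size S) (size (proj₁ (insert S x y a b))) (suc L)
  insert-amortised S x y a b = amortised (+-cancelʳ-≤ (length ts) _ _ (begin
    d + L + size S′ + length ts      ≡⟨ +-assoc (d + L) _ _ ⟩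
    d + L + (size S′ + length ts)    ≡⟨ cong (d + L +_) (size-setEntry S x y ts′) ⟩
    d + L + (size S + length ts′)    ≡⟨ regroup d L (size S) (length ts′) ⟩
    size S + L + (d + length ts′)    ≤⟨ +-monoʳ-≤ (size S + L) (insertTree-length (a , b) ts) ⟩
    size S + L + suc (length ts)     ≡⟨ +-suc (size S + L) _ ⟩
    suc (size S + L + length ts)     ≡⟨ cong (_+ length ts) (+-suc (size S) L) ⟨
    size S + suc L + length ts       ∎))
    where
    open ≤-Reasoning
    ts  = S x y
    ts′ = proj₁ (insertTree (a , b) ts)
    d   = proj₂ (insertTree (a , b) ts)
    S′  = setEntry S x y ts′
    regroup : ∀ d L s l → d + L + (s + l) ≡ s + L + (d + l)
    regroup = solve-∀

  step3-amortised : ∀ S u v t ws D →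
    Amortised (proj₂ (proj₂ (step3 S u v t ws D))) (size S) (size (proj₁ (step3 S u v t ws D)))
              (length ws * step3Budget L)
  step3-amortised S u v t []       D = pay 0 (size S)
  step3-amortised S u v t (w ∷ ws) D with findPrevious (S w u) t
  ... | nothing       = relax (+-monoˡ-≤ _ (≤-trans (m≤m+n L (suc L)) (m≤m+n _ 1)))
                          (pay L (size S) ⨾ step3-amortised S u v t ws D)
  ... | just (tm , _) = pay L (size S) ⨾ insert-amortised S w v tm (t + δ) ⨾ pay 1 _
                          ⨾ step3-amortised _ u v t ws ((w , tm) ∷ D)

  step3-length : ∀ S u v t ws D → length (proj₁ (proj₂ (step3 S u v t ws D))) ≤ length ws + length D
  step3-length S u v t []       D = ≤-refl
  step3-length S u v t (w ∷ ws) D with findPrevious (S w u) t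
  ... | nothing       = m≤n⇒m≤1+n (step3-length S u v t ws D)
  ... | just (tm , _) = ≤-trans (step3-length _ u v t ws ((w , tm) ∷ D)) (≤-reflexive (+-suc _ _))

  insertD-amortised : ∀ S w tp D →
    Amortised (proj₂ (insertD S w tp D)) (size S) (size (proj₁ (insertD S w tp D)))
              (length D * insertDBudget L)
  insertD-amortised S w tp []              = pay 0 (size S)
  insertD-amortised S w tp ((wm , tm) ∷ D) with wm ≟ w
  ... | yes _ = relax (+-monoˡ-≤ _ (s≤s z≤n)) (pay 1 (size S) ⨾ insertD-amortised S w tp D)
  ... | no  _ = pay 1 (size S) ⨾ insert-amortised S wm w tm tp ⨾ insertD-amortised _ w tp D

  step4-amortised : ∀ S u v t D ws →
    Amortised (proj₂ (step4 S u v t D ws)) (size S) (size (proj₁ (step4 S u v t D ws)))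
              (length ws * step4Budget L (length D))
  step4-amortised S u v t D []       = pay 0 (size S)
  step4-amortised S u v t D (w ∷ ws) with findNext (S v w) (t + δ)
  ... | nothing       = relax (+-monoˡ-≤ _ (≤-trans (m≤m+n L (suc L)) (m≤m+n _ _)))
                          (pay L (size S) ⨾ step4-amortised S u v t D ws)
  ... | just (_ , tp) = pay L (size S) ⨾ insert-amortised S u w t tp ⨾ insertD-amortised _ w tp D
                          ⨾ step4-amortised _ u v t D ws

  length-scan≤ : ∀ (p : Fin n → Bool) → length (filterᵇ p (allFin n)) ≤ n
  length-scan≤ p = ≤-trans (List.length-filter _ (allFin n)) (≤-reflexive (List.length-tabulate id))

  addContact-amortised : ∀ S c →
    Amortised (proj₂ (addContact S c)) (size S) (size (proj₁ (addContact S c))) (addContactBudget n L)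
  addContact-amortised S (contact u v t) = relax budget≤
    (pay 1 (size S) ⨾ insert-amortised S u v t (t + δ) ⨾ pay n _ ⨾ step3-amortised S₁ u v t (Nin S₁ u) []
      ⨾ pay n _ ⨾ step4-amortised S₂ u v t D (Nout S₂ v))
    where
    S₁ S₂ : State n
    S₁ = proj₁ (insert S u v t (t + δ))
    S₂ = proj₁ (step3 S₁ u v t (Nin S₁ u) [])
    D : List (Fin n × ℕ)
    D = proj₁ (proj₂ (step3 S₁ u v t (Nin S₁ u) []))
    |Nin|≤n : length (Nin S₁ u) ≤ n
    |Nin|≤n = length-scan≤ _
    |Nout|≤n : length (Nout S₂ v) ≤ n
    |Nout|≤n = length-scan≤ _
    |D|≤n : length D ≤ n
    |D|≤n = ≤-trans (step3-length S₁ u v t (Nin S₁ u) []) (≤-trans (≤-reflexive (+-identityʳ _)) |Nin|≤n)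
    budget≤ : 1 + suc L + n + length (Nin S₁ u) * step3Budget L + n
                + length (Nout S₂ v) * step4Budget L (length D) ≤ addContactBudget n L
    budget≤ = +-mono-≤ (+-monoˡ-≤ n (+-monoʳ-≤ (1 + suc L + n) (*-monoˡ-≤ _ |Nin|≤n)))
                       (*-mono-≤ |Nout|≤n (+-monoʳ-≤ (L + suc L) (*-monoˡ-≤ _ |D|≤n)))

  run-amortised : ∀ S cs →
    Amortised (proj₂ (run S cs)) (size S) (size (proj₁ (run S cs))) (length cs * (15 * (n * n * L)))
  run-amortised S []       = pay 0 (size S)
  run-amortised S (c ∷ cs) = relax (addContactBudget≤ (Contact.src c) ⌈log₂ τ ⌉) (addContact-amortised S c)
                             ⨾ run-amortised _ cs

  size-empty : size (emptyState n) ≡ 0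
  size-empty = trans (sum-cong-≗ {n} λ _ → sum-replicate-zero n) (sum-replicate-zero n)

  amortised-bound : ∀ cs → proj₂ (run (emptyState n) cs) ≤ 15 * length cs * (n * n) * L
  amortised-bound cs = ≤-trans (Amortised⇒cost≤ (run-amortised (emptyState n) cs))
    (≤-reflexive (trans (cong (_+ length cs * (15 * (n * n * L))) size-empty) (reassoc (length cs) (n * n) L)))
    where
    reassoc : ∀ k m l → 0 + k * (15 * (m * l)) ≡ 15 * k * m * l
    reassoc = solve-∀

  ProperState : State n → Set
  ProperState S = ∀ x y → Proper τ (S x y)

  BoundedDepartures : List (Fin n × ℕ) → Set
  BoundedDepartures = All λ (_ , tm) → tm ≤ τ

  insert-proper : ∀ {S} x y {a} b → a ≤ τ → ProperState S → ProperState (proj₁ (insert S x y a b))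
  insert-proper {S} x y {a} b a≤τ p x′ y′ with x′ ≟ x | y′ ≟ y
  ... | yes refl | yes refl = insertTree-proper (a , b) (S x y) a≤τ (p x y)
  ... | yes _    | no  _    = p x′ y′
  ... | no  _    | _        = p x′ y′

  step3-proper : ∀ S u v t ws D → ProperState S → BoundedDepartures D →
    ProperState (proj₁ (step3 S u v t ws D)) × BoundedDepartures (proj₁ (proj₂ (step3 S u v t ws D)))
  step3-proper S u v t []       D p D≤τ = p , D≤τ
  step3-proper S u v t (w ∷ ws) D p D≤τ with findPrevious (S w u) t in found
  ... | nothing        = step3-proper S u v t ws D p D≤τ
  ... | just (tm , tp) = step3-proper _ u v t ws ((w , tm) ∷ D) (insert-proper w v (t + δ) tm≤τ p) (tm≤τ ∷ D≤τ)
    where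
    tm≤τ : tm ≤ τ
    tm≤τ = All.lookup (Proper.bounded (p w u)) (findPrevious-∈ (S w u) found)

  insertD-proper : ∀ S w tp D → ProperState S → BoundedDepartures D → ProperState (proj₁ (insertD S w tp D))
  insertD-proper S w tp []              p _            = p
  insertD-proper S w tp ((wm , tm) ∷ D) p (tm≤τ ∷ D≤τ) with wm ≟ w
  ... | yes _ = insertD-proper S w tp D p D≤τ
  ... | no  _ = insertD-proper _ w tp D (insert-proper wm w tp tm≤τ p) D≤τ

  step4-proper : ∀ S u v t D ws → t ≤ τ → ProperState S → BoundedDepartures D →
    ProperState (proj₁ (step4 S u v t D ws))
  step4-proper S u v t D []       t≤τ p D≤τ = p
  step4-proper S u v t D (w ∷ ws) t≤τ p D≤τ with findNext (S v w) (t + δ)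
  ... | nothing       = step4-proper S u v t D ws t≤τ p D≤τ
  ... | just (_ , tp) = step4-proper _ u v t D ws t≤τ (insertD-proper _ w tp D (insert-proper u w tp t≤τ p) D≤τ) D≤τ

  addContact-proper : ∀ S c → Valid τ c → ProperState S → ProperState (proj₁ (addContact S c))
  addContact-proper S (contact u v t) valid p = step4-proper S₂ u v t D (Nout S₂ v) t≤τ S₂-proper D≤τ
    where
    t≤τ : t ≤ τ
    t≤τ = Valid.upper valid
    S₁ S₂ : State n
    S₁ = proj₁ (insert S u v t (t + δ))
    S₂ = proj₁ (step3 S₁ u v t (Nin S₁ u) [])
    D : List (Fin n × ℕ)
    D = proj₁ (proj₂ (step3 S₁ u v t (Nin S₁ u) []))
    S₂-proper×D≤τ : ProperState S₂ × BoundedDepartures D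
    S₂-proper×D≤τ = step3-proper S₁ u v t (Nin S₁ u) [] (insert-proper u v (t + δ) t≤τ p) []
    S₂-proper : ProperState S₂
    S₂-proper = proj₁ S₂-proper×D≤τ
    D≤τ : BoundedDepartures D
    D≤τ = proj₂ S₂-proper×D≤τ

  run-proper : ∀ S cs → All (Valid τ) cs → ProperState S → ProperState (proj₁ (run S cs))
  run-proper S []       []               p = p
  run-proper S (c ∷ cs) (valid ∷ valids) p = run-proper _ cs valids (addContact-proper S c valid p)

  reachable-proper : ∀ cs → All (Valid τ) cs → ProperState (stateAfter cs)
  reachable-proper cs valids = run-proper (emptyState n) cs valids λ _ _ → record { distinct = [] ; bounded = [] }

  size≤ : ∀ {S} → ProperState S → size S ≤ n * (n * suc τ)
  size≤ p = sum-≤-* _ λ x → sum-≤-* _ λ y → Proper-length≤ (p x y)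

  worstCase-bound : ∀ S → ProperState S → ∀ c → Valid τ c → proj₂ (addContact S c) ≤ 32 * (n * n) * τ
  worstCase-bound S p c valid = begin
    proj₂ (addContact S c)              ≤⟨ Amortised⇒cost≤ (addContact-amortised S c) ⟩
    size S + addContactBudget n L       ≤⟨ +-mono-≤ (size≤ p) (addContactBudget≤ (Contact.src c) ⌈log₂ τ ⌉) ⟩
    n * (n * suc τ) + 15 * (n * n * L)  ≤⟨ stored+budget≤ n (≤-trans (Valid.lower valid) (Valid.upper valid)) logCost≤1+ ⟩
    32 * (n * n) * τ                    ∎
    where open ≤-Reasoning

theorem1 :
    (Σ ℕ λ C → (n τ δ : ℕ) (cs : List (Contact n)) → All (Valid τ) cs →
        proj₂ (Algorithm.run n τ δ (emptyState n) cs)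
          ≤ C * length cs * (n * n) * logCost τ)
    ×
    (Σ ℕ λ C → (n τ δ : ℕ) (cs : List (Contact n)) → All (Valid τ) cs →
        (c : Contact n) → Valid τ c →
        proj₂ (Algorithm.addContact n τ δ (Algorithm.stateAfter n τ δ cs) c)
          ≤ C * (n * n) * τ)
-- The amortised bound holds for arbitrary contacts; validity is only needed
-- for the worst case.
theorem1 =
    (15 , λ n τ δ cs _ → Analysis.amortised-bound n τ δ cs)
  , (32 , λ n τ δ cs valids c valid →
           Analysis.worstCase-bound n τ δ _ (Analysis.reachable-proper n τ δ cs valids) c valid)
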